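{- For every classical formula $Z\in$ FC: $Z$ is a theorem of classical propositional logic LC if and only if its translation $Z'$ is a valid graph of Alfa-LC (i.e. $Z'$ is obtained from $\lambda$ by finitely many applications of the rules of RTRAC).
   Context: FC: the formulas built from a countably infinite set of atoms $a,b,c,\dots$ using $\sim$, $\supset$, $\bullet$, $\cup$, $\equiv$. Theorems of LC: formulas derivable by modus ponens from instances (in FC) of: $X\supset(Y\supset X)$; $(X\supset(Y\supset Z))\supset((X\supset Y)\supset(X\supset Z))$; $X\supset(X\cup Y)$; $Y\supset(X\cup Y)$; $(X\supset Z)\supset((Y\supset Z)\supset((X\cup Y)\supset Z))$; $(X\bullet Y)\supset X$; $(X\bullet Y)\supset Y$; $(X\supset Y)\supset((X\supset Z)\supset(X\supset(Y\bullet Z)))$; $X\supset(\sim X\supset Y)$; $X\cup\sim X$; $(X\equiv Y)\supset(X\supset Y)$; $(X\equiv Y)\supset(Y\supset X)$; $(X\supset Y)\supset((Y\supset X)\supset(X\equiv Y))$. Alfa-LC graphs: built from the empty graph $\lambda$ and atoms by juxtaposition $XY$ (commutative, associative) and cut $(X)$. An occurrence is in an even (odd) region if enclosed by an even (odd) number of cuts. Rules RTRAC (each replaces an occurrence inside any graph): R$\lambda$: $\lambda$ is valid; erasure: $XY$ in an even region $\Rightarrow X$ (or $Y$); insertion: $X$ in an odd region $\Rightarrow XY$ (or $YX$); double cut: $X\Leftrightarrow((X))$; DCC$\lambda$: $((\lambda))$ and $(())$ are valid; iteration $X\Rightarrow XX$; deiteration $XX\Rightarrow X$; classical iteration/deiteration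 $X\,G_n(Y)\Leftrightarrow X\,G_n(XY)$ with $G_0(Y)=Y_0Y$, $G_{k+1}(Y)=Y_{k+1}(G_k(Y))$ for arbitrary graphs $Y_i$. Translation: $a'=a$, $(\sim X)'=(X')$, $(X\bullet Y)'=X'Y'$, $(X\supset Y)'=(X'(Y'))$, $(X\equiv Y)'=(X'(Y'))(Y'(X'))$, $(X\cup Y)'=((X')(Y'))$. -}

module Defs where

open import Data.Nat using (ℕ; zero; suc)
open import Data.Vec using (Vec; []; _∷_)

infixr 5 _⊃_
infixr 6 _∪_
infixr 7 _•_
infix  4 _≣_

data Formula : Set where
  atom : ℕ → Formula
  ∼_   : Formula → Formula
  _⊃_  : Formula → Formula → Formula
  _•_  : Formula → Formula → Formula
  _∪_  : Formula → Formula → Formula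
  _≣_  : Formula → Formula → Formula

data LC : Formula → Set where
  ax1  : ∀ X Y → LC (X ⊃ (Y ⊃ X))
  ax2  : ∀ X Y Z → LC ((X ⊃ (Y ⊃ Z)) ⊃ ((X ⊃ Y) ⊃ (X ⊃ Z)))
  ax3  : ∀ X Y → LC (X ⊃ (X ∪ Y))
  ax4  : ∀ X Y → LC (Y ⊃ (X ∪ Y))
  ax5  : ∀ X Y Z → LC ((X ⊃ Z) ⊃ ((Y ⊃ Z) ⊃ ((X ∪ Y) ⊃ Z)))
  ax6  : ∀ X Y → LC ((X • Y) ⊃ X)
  ax7  : ∀ X Y → LC ((X • Y) ⊃ Y)
  ax8  : ∀ X Y Z → LC ((X ⊃ Y) ⊃ ((X ⊃ Z) ⊃ (X ⊃ (Y • Z))))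
  ax9  : ∀ X Y → LC (X ⊃ (∼ X ⊃ Y))
  ax10 : ∀ X → LC (X ∪ ∼ X)
  ax11 : ∀ X Y → LC ((X ≣ Y) ⊃ (X ⊃ Y))
  ax12 : ∀ X Y → LC ((X ≣ Y) ⊃ (Y ⊃ X))
  ax13 : ∀ X Y → LC ((X ⊃ Y) ⊃ ((Y ⊃ X) ⊃ (X ≣ Y)))
  mp   : ∀ {X Y} → LC (X ⊃ Y) → LC X → LC Y

-- Alfa graphs: syntax, with juxtaposition taken modulo
-- associativity, commutativity and the empty graph λ as unit (_≈_)

infixl 6 _⊕_

data Graph : Set where
  λg   : Graph
  at   : ℕ → Graph
  _⊕_  : Graph → Graph → Graph
  cut  : Graph → Graph

infix 4 _≈_

data _≈_ : Graph → Graph → Set where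
  ≈-refl  : ∀ {X} → X ≈ X
  ≈-sym   : ∀ {X Y} → X ≈ Y → Y ≈ X
  ≈-trans : ∀ {X Y Z} → X ≈ Y → Y ≈ Z → X ≈ Z
  ≈-⊕     : ∀ {X X′ Y Y′} → X ≈ X′ → Y ≈ Y′ → X ⊕ Y ≈ X′ ⊕ Y′
  ≈-cut   : ∀ {X X′} → X ≈ X′ → cut X ≈ cut X′
  ≈-assoc : ∀ X Y Z → (X ⊕ Y) ⊕ Z ≈ X ⊕ (Y ⊕ Z)
  ≈-comm  : ∀ X Y → X ⊕ Y ≈ Y ⊕ X
  ≈-unit  : ∀ X → λg ⊕ X ≈ X

-- Contexts: a graph with one hole; the hole marks an occurrence.
data Ctx : Set where
  hole : Ctx
  jux  : Ctx → Graph → Ctx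
  cutC : Ctx → Ctx

plug : Ctx → Graph → Graph
plug hole     X = X
plug (jux C G) X = plug C X ⊕ G
plug (cutC C) X = cut (plug C X)

data Even : Ctx → Set
data Odd  : Ctx → Set

data Even where
  even-hole : Even hole
  even-jux  : ∀ {C G} → Even C → Even (jux C G)
  even-cut  : ∀ {C} → Odd C → Even (cutC C)

data Odd where
  odd-jux : ∀ {C G} → Odd C → Odd (jux C G)
  odd-cut : ∀ {C} → Even C → Odd (cutC C)

-- G_n(Y): Gn k (Y_k ∷ … ∷ Y_0 ∷ []) Y, with
-- G_0(Y) = Y_0 Y  and  G_{k+1}(Y) = Y_{k+1} (G_k(Y))
Gn : (n : ℕ) → Vec Graph (suc n) → Graph → Graph
Gn zero    (Y₀ ∷ [])  Y = Y₀ ⊕ Y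
Gn (suc k) (Yk ∷ Ys) Y = Yk ⊕ cut (Gn k Ys Y)

data Step : Graph → Graph → Set where
  erasureˡ   : ∀ {C} X Y → Even C → Step (plug C (X ⊕ Y)) (plug C X)
  erasureʳ   : ∀ {C} X Y → Even C → Step (plug C (X ⊕ Y)) (plug C Y)
  insertionˡ : ∀ {C} X Y → Odd C → Step (plug C X) (plug C (X ⊕ Y))
  insertionʳ : ∀ {C} X Y → Odd C → Step (plug C X) (plug C (Y ⊕ X))
  dcut-in    : ∀ C X → Step (plug C X) (plug C (cut (cut X)))
  dcut-out   : ∀ C X → Step (plug C (cut (cut X))) (plug C X)
  iteration  : ∀ C X → Step (plug C X) (plug C (X ⊕ X))
  deiteration : ∀ C X → Step (plug C (X ⊕ X)) (plug C X)
  c-iteration : ∀ C X n (Ys : Vec Graph (suc n)) Y →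
    Step (plug C (X ⊕ Gn n Ys Y)) (plug C (X ⊕ Gn n Ys (X ⊕ Y)))
  c-deiteration : ∀ C X n (Ys : Vec Graph (suc n)) Y →
    Step (plug C (X ⊕ Gn n Ys (X ⊕ Y))) (plug C (X ⊕ Gn n Ys Y))

data Valid : Graph → Set where
  Rλ     : Valid λg
  DCCλ   : Valid (cut (cut λg))   -- ((λ)); (()) is the same graph, as () = (λ)
  step   : ∀ {G H} → Valid G → Step G H → Valid H
  resp≈  : ∀ {G H} → Valid G → G ≈ H → Valid H

infix 10 _′
_′ : Formula → Graph
atom a ′  = at a
(∼ X) ′   = cut (X ′)
(X • Y) ′ = X ′ ⊕ Y ′
(X ⊃ Y) ′ = cut (X ′ ⊕ cut (Y ′))
(X ≣ Y) ′ = cut (X ′ ⊕ cut (Y ′)) ⊕ cut (Y ′ ⊕ cut (X ′))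
(X ∪ Y) ′ = cut (cut (X ′) ⊕ cut (Y ′))

-- A graph derivation H ⇒* X, read as "X follows from H", behaves like a
-- classical natural deduction: erasure gives the projections, iteration
-- contraction, and classical (de)iteration across one or two cuts gives
-- modus ponens and the deduction theorem for the graph implication
-- (A (B)).  Hence every LC axiom translates to a graph derivable from λ.
-- Conversely, reading juxtaposition as ∧ and a cut as ¬, every rule of RTRAC
-- preserves truth (erasure and insertion because a region of even depth
-- is monotone and one of odd depth antitone), so Z′ valid makes Z a
-- tautology, and tautologies are LC-theorems by Kalmár's argument.
module Submission where

open import Defs
open import Function using (_∘_)
open import Function.Bundles using (_⇔_; mk⇔)
open import Data.Nat using (ℕ; suc)
open import Data.Nat.Properties using (_≟_)
open import Data.Vec using (Vec; []; _∷_)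
open import Data.Bool using (Bool; true; false; not; _∧_; _≤_; f≤t; b≤b)
open import Data.Bool.Properties
  using (∧-assoc; ∧-comm; ∧-idem; not-involutive; ≤-reflexive; ≤-antisym; ≤-minimum; ≤-maximum)
open import Data.List using (List; []; _∷_; _++_)
open import Data.List.Membership.Propositional using (_∈_)
open import Data.List.Membership.Propositional.Properties using (∈-++⁺ˡ; ∈-++⁺ʳ)
open import Data.List.Relation.Unary.Any using (here; there; tail)
open import Relation.Nullary using (yes; no)
open import Relation.Binary.PropositionalEquality

infixr 4 _▸_
infix  3 _⇒*_

data _⇒*_ : Graph → Graph → Set where
  ≈⇒  : ∀ {G H} → G ≈ H → G ⇒* H
  ⟨_⟩ : ∀ {G H} → Step G H → G ⇒* H
  _▸_ : ∀ {G H K} → G ⇒* H → H ⇒* K → G ⇒* K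

≡⇒ : ∀ {G H} → G ≡ H → G ⇒* H
≡⇒ refl = ≈⇒ ≈-refl

valid-⇒* : ∀ {G H} → Valid G → G ⇒* H → Valid H
valid-⇒* v (≈⇒ e)   = resp≈ v e
valid-⇒* v ⟨ s ⟩    = step v s
valid-⇒* v (d ▸ d′) = valid-⇒* (valid-⇒* v d) d′

infixr 9 _∘ᶜ_

_∘ᶜ_ : Ctx → Ctx → Ctx
hole     ∘ᶜ C = C
jux D G  ∘ᶜ C = jux (D ∘ᶜ C) G
cutC D   ∘ᶜ C = cutC (D ∘ᶜ C)

plug-∘ᶜ : ∀ D C X → plug (D ∘ᶜ C) X ≡ plug D (plug C X)
plug-∘ᶜ hole      C X = refl
plug-∘ᶜ (jux D G) C X = cong (_⊕ G) (plug-∘ᶜ D C X)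
plug-∘ᶜ (cutC D)  C X = cong cut (plug-∘ᶜ D C X)

plug-cong : ∀ C {X Y} → X ≈ Y → plug C X ≈ plug C Y
plug-cong hole      e = e
plug-cong (jux C G) e = ≈-⊕ (plug-cong C e) ≈-refl
plug-cong (cutC C)  e = ≈-cut (plug-cong C e)

even-∘ᶜ-even : ∀ {D C} → Even D → Even C → Even (D ∘ᶜ C)
even-∘ᶜ-odd  : ∀ {D C} → Even D → Odd C → Odd (D ∘ᶜ C)
odd-∘ᶜ-even  : ∀ {D C} → Odd D → Even C → Odd (D ∘ᶜ C)
odd-∘ᶜ-odd   : ∀ {D C} → Odd D → Odd C → Even (D ∘ᶜ C)
even-∘ᶜ-even even-hole    eC = eC
even-∘ᶜ-even (even-jux e) eC = even-jux (even-∘ᶜ-even e eC)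
even-∘ᶜ-even (even-cut o) eC = even-cut (odd-∘ᶜ-even o eC)
even-∘ᶜ-odd  even-hole    oC = oC
even-∘ᶜ-odd  (even-jux e) oC = odd-jux (even-∘ᶜ-odd e oC)
even-∘ᶜ-odd  (even-cut o) oC = odd-cut (odd-∘ᶜ-odd o oC)
odd-∘ᶜ-even  (odd-jux o)  eC = odd-jux (odd-∘ᶜ-even o eC)
odd-∘ᶜ-even  (odd-cut e)  eC = odd-cut (even-∘ᶜ-even e eC)
odd-∘ᶜ-odd   (odd-jux o)  oC = even-jux (odd-∘ᶜ-odd o oC)
odd-∘ᶜ-odd   (odd-cut e)  oC = even-cut (even-∘ᶜ-odd e oC)

step-∘ᶜ : ∀ D C {X Y} → Step (plug (D ∘ᶜ C) X) (plug (D ∘ᶜ C) Y) →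
          plug D (plug C X) ⇒* plug D (plug C Y)
step-∘ᶜ D C {X} {Y} s = ≡⇒ (sym (plug-∘ᶜ D C X)) ▸ ⟨ s ⟩ ▸ ≡⇒ (plug-∘ᶜ D C Y)

-- Erasure and insertion are only sound at one parity, so a derivation can
-- be transported into even contexts only.
plug-step : ∀ D {G H} → Even D → Step G H → plug D G ⇒* plug D H
plug-step D eD (erasureˡ {C} X Y e)       = step-∘ᶜ D C (erasureˡ X Y (even-∘ᶜ-even eD e))
plug-step D eD (erasureʳ {C} X Y e)       = step-∘ᶜ D C (erasureʳ X Y (even-∘ᶜ-even eD e))
plug-step D eD (insertionˡ {C} X Y o)     = step-∘ᶜ D C (insertionˡ X Y (even-∘ᶜ-odd eD o))
plug-step D eD (insertionʳ {C} X Y o)     = step-∘ᶜ D C (insertionʳ X Y (even-∘ᶜ-odd eD o))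
plug-step D eD (dcut-in C X)              = step-∘ᶜ D C (dcut-in (D ∘ᶜ C) X)
plug-step D eD (dcut-out C X)             = step-∘ᶜ D C (dcut-out (D ∘ᶜ C) X)
plug-step D eD (iteration C X)            = step-∘ᶜ D C (iteration (D ∘ᶜ C) X)
plug-step D eD (deiteration C X)          = step-∘ᶜ D C (deiteration (D ∘ᶜ C) X)
plug-step D eD (c-iteration C X n Ys Y)   = step-∘ᶜ D C (c-iteration (D ∘ᶜ C) X n Ys Y)
plug-step D eD (c-deiteration C X n Ys Y) = step-∘ᶜ D C (c-deiteration (D ∘ᶜ C) X n Ys Y)

plug-⇒* : ∀ D {G H} → Even D → G ⇒* H → plug D G ⇒* plug D H
plug-⇒* D eD (≈⇒ e)   = ≈⇒ (plug-cong D e)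
plug-⇒* D eD ⟨ s ⟩    = plug-step D eD s
plug-⇒* D eD (d ▸ d′) = plug-⇒* D eD d ▸ plug-⇒* D eD d′

infixr 5 _⊸_
infixr 6 _∨ᵍ_

_⊸_ : Graph → Graph → Graph
A ⊸ B = cut (A ⊕ cut B)

_∨ᵍ_ : Graph → Graph → Graph
A ∨ᵍ B = cut (cut A ⊕ cut B)

⊥ᵍ : Graph
⊥ᵍ = cut λg

⊕-identityʳ : ∀ X → X ⊕ λg ≈ X
⊕-identityʳ X = ≈-trans (≈-comm X λg) (≈-unit X)

drop-right : ∀ {H K} → H ⊕ K ⇒* H
drop-right {H} {K} = ⟨ erasureˡ {hole} H K even-hole ⟩

drop-left : ∀ {H K} → K ⊕ H ⇒* H
drop-left {H} {K} = ⟨ erasureʳ {hole} K H even-hole ⟩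

⊕-monoˡ : ∀ {G G′ K} → G ⇒* G′ → G ⊕ K ⇒* G′ ⊕ K
⊕-monoˡ {K = K} = plug-⇒* (jux hole K) (even-jux even-hole)

⊕-monoʳ : ∀ {G G′ K} → G ⇒* G′ → K ⊕ G ⇒* K ⊕ G′
⊕-monoʳ {G} {G′} {K} d = ≈⇒ (≈-comm K G) ▸ ⊕-monoˡ d ▸ ≈⇒ (≈-comm G′ K)

⊸-monoʳ : ∀ {A G G′} → G ⇒* G′ → A ⊸ G ⇒* A ⊸ G′
⊸-monoʳ {A} {G} {G′} d =
  ≈⇒ (≈-cut (≈-comm A (cut G)))
  ▸ plug-⇒* (cutC (jux (cutC hole) A)) (even-cut (odd-jux (odd-cut even-hole))) d
  ▸ ≈⇒ (≈-cut (≈-comm (cut G′) A))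

⟨_,_⟩ : ∀ {H P Q} → H ⇒* P → H ⇒* Q → H ⇒* P ⊕ Q
⟨ d₁ , d₂ ⟩ = ⟨ iteration hole _ ⟩ ▸ ⊕-monoˡ d₁ ▸ ⊕-monoʳ d₂

weaken : ∀ {H K P} → H ⇒* P → H ⊕ K ⇒* P
weaken d = drop-right ▸ d

var₀ : ∀ {H A} → H ⊕ A ⇒* A
var₀ = drop-left

var₁ : ∀ {H A B} → (H ⊕ A) ⊕ B ⇒* A
var₁ = weaken var₀

var₂ : ∀ {H A B C} → ((H ⊕ A) ⊕ B) ⊕ C ⇒* A
var₂ = weaken var₁

exchange : ∀ {H X Y} → (H ⊕ X) ⊕ Y ⇒* (H ⊕ Y) ⊕ X
exchange {H} {X} {Y} = ≈⇒ (≈-trans (≈-assoc H X Y)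
  (≈-trans (≈-⊕ ≈-refl (≈-comm X Y)) (≈-sym (≈-assoc H Y X))))

-- Classical (de)iteration of X into one (G₁) or two (G₂) nested cuts; the
-- graphs Yᵢ not needed are taken to be λ.
G₁-λ : ∀ Y → λg ⊕ cut (λg ⊕ Y) ≈ cut Y
G₁-λ Y = ≈-trans (≈-unit _) (≈-cut (≈-unit Y))

c-iterate₁ : ∀ C X Z → plug C (X ⊕ cut Z) ⇒* plug C (X ⊕ cut (X ⊕ Z))
c-iterate₁ C X Z =
  ≈⇒ (plug-cong C (≈-⊕ ≈-refl (≈-sym (G₁-λ Z))))
  ▸ ⟨ c-iteration C X 1 (λg ∷ λg ∷ []) Z ⟩
  ▸ ≈⇒ (plug-cong C (≈-⊕ ≈-refl (G₁-λ (X ⊕ Z))))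

c-deiterate₁ : ∀ X Z → X ⊕ cut (X ⊕ Z) ⇒* X ⊕ cut Z
c-deiterate₁ X Z =
  ≈⇒ (≈-⊕ ≈-refl (≈-sym (G₁-λ (X ⊕ Z))))
  ▸ ⟨ c-deiteration hole X 1 (λg ∷ λg ∷ []) Z ⟩
  ▸ ≈⇒ (≈-⊕ ≈-refl (G₁-λ Z))

c-iterate₂ : ∀ X Y Z → X ⊕ (Y ⊸ Z) ⇒* X ⊕ (Y ⊸ X ⊕ Z)
c-iterate₂ X Y Z =
  ≈⇒ (≈-⊕ ≈-refl (≈-sym (G₂-λ Z)))
  ▸ ⟨ c-iteration hole X 2 (λg ∷ Y ∷ λg ∷ []) Z ⟩
  ▸ ≈⇒ (≈-⊕ ≈-refl (G₂-λ (X ⊕ Z)))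
  where
  G₂-λ : ∀ W → λg ⊕ cut (Y ⊕ cut (λg ⊕ W)) ≈ Y ⊸ W
  G₂-λ W = ≈-trans (≈-unit _) (≈-cut (≈-⊕ ≈-refl (≈-cut (≈-unit W))))

⊸-refl : ∀ A → λg ⇒* A ⊸ A
⊸-refl A =
  ⟨ dcut-in hole λg ⟩
  ▸ ⟨ insertionʳ {cutC hole} ⊥ᵍ A (odd-cut even-hole) ⟩
  ▸ c-iterate₁ (cutC hole) A λg
  ▸ ≈⇒ (≈-cut (≈-⊕ ≈-refl (≈-cut (⊕-identityʳ A))))

⊸-intro : ∀ {H A B} → H ⊕ A ⇒* B → H ⇒* A ⊸ B
⊸-intro {H} {A} d =
  ≈⇒ (≈-sym (⊕-identityʳ H))
  ▸ ⊕-monoʳ (⊸-refl A)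
  ▸ c-iterate₂ H A A
  ▸ ⊕-monoʳ (⊸-monoʳ d)
  ▸ drop-left

modus-ponens : ∀ {A B} → A ⊕ (A ⊸ B) ⇒* B
modus-ponens {A} {B} = c-deiterate₁ A (cut B) ▸ drop-left ▸ ⟨ dcut-out hole B ⟩

⊸-elim : ∀ {H A B} → H ⇒* A ⊸ B → H ⇒* A → H ⇒* B
⊸-elim d₁ d₂ = ⟨ d₂ , d₁ ⟩ ▸ modus-ponens

contradiction : ∀ {H P} → H ⇒* P → H ⇒* cut P → H ⇒* ⊥ᵍ
contradiction {P = P} d₁ d₂ =
  ⟨ d₁ , d₂ ⟩ ▸ ≈⇒ (≈-⊕ ≈-refl (≈-cut (≈-sym (⊕-identityʳ P)))) ▸ c-deiterate₁ P λg ▸ drop-left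

cut-intro : ∀ {H A} → H ⊕ A ⇒* ⊥ᵍ → H ⇒* cut A
cut-intro {A = A} d =
  ⊸-intro d
  ▸ ≈⇒ (≈-cut (≈-comm A (cut ⊥ᵍ)))
  ▸ ⟨ dcut-out (cutC (jux hole A)) λg ⟩
  ▸ ≈⇒ (≈-cut (≈-unit A))

by-contradiction : ∀ {H C} → H ⊕ cut C ⇒* ⊥ᵍ → H ⇒* C
by-contradiction {C = C} d = cut-intro d ▸ ⟨ dcut-out hole C ⟩

⊥ᵍ-elim : ∀ {H C} → H ⇒* ⊥ᵍ → H ⇒* C
⊥ᵍ-elim d = by-contradiction (weaken d)

∨ᵍ-introˡ : ∀ {H A B} → H ⇒* A → H ⇒* A ∨ᵍ B
∨ᵍ-introˡ {A = A} {B} d =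
  d ▸ ⟨ dcut-in hole A ⟩ ▸ ⟨ insertionˡ {cutC hole} (cut A) (cut B) (odd-cut even-hole) ⟩

∨ᵍ-introʳ : ∀ {H A B} → H ⇒* B → H ⇒* A ∨ᵍ B
∨ᵍ-introʳ {A = A} {B} d =
  d ▸ ⟨ dcut-in hole B ⟩ ▸ ⟨ insertionʳ {cutC hole} (cut B) (cut A) (odd-cut even-hole) ⟩

∨ᵍ-elim : ∀ {H A B C} → H ⇒* A ∨ᵍ B → H ⊕ A ⇒* C → H ⊕ B ⇒* C → H ⇒* C
∨ᵍ-elim d dA dB = by-contradiction (contradiction ⟨ refute dA , refute dB ⟩ (weaken d))
  where
  refute : ∀ {H A C} → H ⊕ A ⇒* C → H ⊕ cut C ⇒* cut A
  refute dA = cut-intro (contradiction (exchange ▸ weaken dA) var₁)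

LC⇒derivable : ∀ {Z} → LC Z → λg ⇒* Z ′
LC⇒derivable (ax1 X Y)    = ⊸-intro (⊸-intro var₁)
LC⇒derivable (ax2 X Y Z)  = ⊸-intro (⊸-intro (⊸-intro (⊸-elim (⊸-elim var₂ var₀) (⊸-elim var₁ var₀))))
LC⇒derivable (ax3 X Y)    = ⊸-intro (∨ᵍ-introˡ var₀)
LC⇒derivable (ax4 X Y)    = ⊸-intro (∨ᵍ-introʳ var₀)
LC⇒derivable (ax5 X Y Z)  =
  ⊸-intro (⊸-intro (⊸-intro (∨ᵍ-elim var₀ (⊸-elim (weaken var₂) var₀) (⊸-elim (weaken var₁) var₀))))
LC⇒derivable (ax6 X Y)    = ⊸-intro (var₀ ▸ drop-right)
LC⇒derivable (ax7 X Y)    = ⊸-intro (var₀ ▸ drop-left)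
LC⇒derivable (ax8 X Y Z)  = ⊸-intro (⊸-intro (⊸-intro ⟨ ⊸-elim var₂ var₀ , ⊸-elim var₁ var₀ ⟩))
LC⇒derivable (ax9 X Y)    = ⊸-intro (⊸-intro (⊥ᵍ-elim (contradiction var₁ var₀)))
LC⇒derivable (ax10 X)     = cut-intro (contradiction (var₀ ▸ drop-right) (var₀ ▸ drop-left))
LC⇒derivable (ax11 X Y)   = ⊸-intro (var₀ ▸ drop-right)
LC⇒derivable (ax12 X Y)   = ⊸-intro (var₀ ▸ drop-left)
LC⇒derivable (ax13 X Y)   = ⊸-intro (⊸-intro ⟨ var₁ , var₀ ⟩)
LC⇒derivable (mp d e)     = ⊸-elim (LC⇒derivable d) (LC⇒derivable e)

Valuation : Set
Valuation = ℕ → Bool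

⟦_⟧_ : Graph → Valuation → Bool
⟦ λg    ⟧ ρ = true
⟦ at n  ⟧ ρ = ρ n
⟦ X ⊕ Y ⟧ ρ = ⟦ X ⟧ ρ ∧ ⟦ Y ⟧ ρ
⟦ cut X ⟧ ρ = not (⟦ X ⟧ ρ)

a∧b≤a : ∀ a b → a ∧ b ≤ a
a∧b≤a false b = b≤b
a∧b≤a true  b = ≤-maximum b

a∧b≤b : ∀ a b → a ∧ b ≤ b
a∧b≤b false b = ≤-minimum b
a∧b≤b true  b     = b≤b

∧-monoˡ-≤ : ∀ c {a b} → a ≤ b → a ∧ c ≤ b ∧ c
∧-monoˡ-≤ c f≤t = ≤-minimum c
∧-monoˡ-≤ c b≤b = b≤b

not-antimono-≤ : ∀ {a b} → a ≤ b → not b ≤ not a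
not-antimono-≤ f≤t = f≤t
not-antimono-≤ b≤b = b≤b

module Truth (ρ : Valuation) where

  ⟦⟧-resp-≈ : ∀ {X Y} → X ≈ Y → ⟦ X ⟧ ρ ≡ ⟦ Y ⟧ ρ
  ⟦⟧-resp-≈ ≈-refl          = refl
  ⟦⟧-resp-≈ (≈-sym e)       = sym (⟦⟧-resp-≈ e)
  ⟦⟧-resp-≈ (≈-trans e e′)  = trans (⟦⟧-resp-≈ e) (⟦⟧-resp-≈ e′)
  ⟦⟧-resp-≈ (≈-⊕ e e′)      = cong₂ _∧_ (⟦⟧-resp-≈ e) (⟦⟧-resp-≈ e′)
  ⟦⟧-resp-≈ (≈-cut e)       = cong not (⟦⟧-resp-≈ e)
  ⟦⟧-resp-≈ (≈-assoc X Y Z) = ∧-assoc (⟦ X ⟧ ρ) (⟦ Y ⟧ ρ) (⟦ Z ⟧ ρ)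
  ⟦⟧-resp-≈ (≈-comm X Y)    = ∧-comm (⟦ X ⟧ ρ) (⟦ Y ⟧ ρ)
  ⟦⟧-resp-≈ (≈-unit X)      = refl

  plug-even-mono : ∀ {C X Y} → Even C → ⟦ X ⟧ ρ ≤ ⟦ Y ⟧ ρ → ⟦ plug C X ⟧ ρ ≤ ⟦ plug C Y ⟧ ρ
  plug-odd-antimono : ∀ {C X Y} → Odd C → ⟦ X ⟧ ρ ≤ ⟦ Y ⟧ ρ → ⟦ plug C Y ⟧ ρ ≤ ⟦ plug C X ⟧ ρ
  plug-even-mono even-hole              le = le
  plug-even-mono (even-jux {G = G} e)   le = ∧-monoˡ-≤ (⟦ G ⟧ ρ) (plug-even-mono e le)
  plug-even-mono (even-cut o)           le = not-antimono-≤ (plug-odd-antimono o le)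
  plug-odd-antimono (odd-jux {G = G} o) le = ∧-monoˡ-≤ (⟦ G ⟧ ρ) (plug-odd-antimono o le)
  plug-odd-antimono (odd-cut e)         le = not-antimono-≤ (plug-even-mono e le)

  plug-cong-⟦⟧ : ∀ C {X Y} → ⟦ X ⟧ ρ ≡ ⟦ Y ⟧ ρ → ⟦ plug C X ⟧ ρ ≡ ⟦ plug C Y ⟧ ρ
  plug-cong-⟦⟧ hole      e = e
  plug-cong-⟦⟧ (jux C G) e = cong (_∧ ⟦ G ⟧ ρ) (plug-cong-⟦⟧ C e)
  plug-cong-⟦⟧ (cutC C)  e = cong not (plug-cong-⟦⟧ C e)

  Gn-cong-⟦⟧ : ∀ n (Ys : Vec Graph (suc n)) {Y Y′} →
               ⟦ Y ⟧ ρ ≡ ⟦ Y′ ⟧ ρ → ⟦ Gn n Ys Y ⟧ ρ ≡ ⟦ Gn n Ys Y′ ⟧ ρ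
  Gn-cong-⟦⟧ 0       (Y₀ ∷ [])  e = cong (⟦ Y₀ ⟧ ρ ∧_) e
  Gn-cong-⟦⟧ (suc n) (Yₖ ∷ Ys) e = cong (λ v → ⟦ Yₖ ⟧ ρ ∧ not v) (Gn-cong-⟦⟧ n Ys e)

  -- If X is false both sides are false; if X is true then X Y and Y agree.
  c-iteration-⟦⟧ : ∀ X n (Ys : Vec Graph (suc n)) Y →
                   ⟦ X ⊕ Gn n Ys Y ⟧ ρ ≡ ⟦ X ⊕ Gn n Ys (X ⊕ Y) ⟧ ρ
  c-iteration-⟦⟧ X n Ys Y with ⟦ X ⟧ ρ in eq
  ... | true  = Gn-cong-⟦⟧ n Ys (sym (cong (_∧ ⟦ Y ⟧ ρ) eq))
  ... | false = refl

  step-sound : ∀ {G H} → Step G H → ⟦ G ⟧ ρ ≤ ⟦ H ⟧ ρ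
  step-sound (erasureˡ X Y e)           = plug-even-mono e (a∧b≤a (⟦ X ⟧ ρ) (⟦ Y ⟧ ρ))
  step-sound (erasureʳ X Y e)           = plug-even-mono e (a∧b≤b (⟦ X ⟧ ρ) (⟦ Y ⟧ ρ))
  step-sound (insertionˡ X Y o)         = plug-odd-antimono o (a∧b≤a (⟦ X ⟧ ρ) (⟦ Y ⟧ ρ))
  step-sound (insertionʳ X Y o)         = plug-odd-antimono o (a∧b≤b (⟦ Y ⟧ ρ) (⟦ X ⟧ ρ))
  step-sound (dcut-in C X)              =
    ≤-reflexive (plug-cong-⟦⟧ C (sym (not-involutive (⟦ X ⟧ ρ))))
  step-sound (dcut-out C X)             = ≤-reflexive (plug-cong-⟦⟧ C (not-involutive (⟦ X ⟧ ρ)))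
  step-sound (iteration C X)            = ≤-reflexive (plug-cong-⟦⟧ C (sym (∧-idem (⟦ X ⟧ ρ))))
  step-sound (deiteration C X)          = ≤-reflexive (plug-cong-⟦⟧ C (∧-idem (⟦ X ⟧ ρ)))
  step-sound (c-iteration C X n Ys Y)   = ≤-reflexive (plug-cong-⟦⟧ C (c-iteration-⟦⟧ X n Ys Y))
  step-sound (c-deiteration C X n Ys Y) =
    ≤-reflexive (plug-cong-⟦⟧ C (sym (c-iteration-⟦⟧ X n Ys Y)))

  valid⇒true : ∀ {G} → Valid G → ⟦ G ⟧ ρ ≡ true
  valid⇒true Rλ          = refl
  valid⇒true DCCλ        = refl
  valid⇒true (step v s)  =
    ≤-antisym (≤-maximum _) (subst (_≤ _) (valid⇒true v) (step-sound s))
  valid⇒true (resp≈ v e) = trans (sym (⟦⟧-resp-≈ e)) (valid⇒true v)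

infix  3 _⊢_
infixl 5 _·_

data _⊢_ (Γ : List Formula) : Formula → Set where
  hyp   : ∀ {A} → A ∈ Γ → Γ ⊢ A
  axiom : ∀ {A} → LC A → Γ ⊢ A
  _·_   : ∀ {A B} → Γ ⊢ A ⊃ B → Γ ⊢ A → Γ ⊢ B

⊢⇒LC : ∀ {A} → [] ⊢ A → LC A
⊢⇒LC (axiom l) = l
⊢⇒LC (d · e)   = mp (⊢⇒LC d) (⊢⇒LC e)

⊃-refl : ∀ A → LC (A ⊃ A)
⊃-refl A = mp (mp (ax2 A (A ⊃ A) A) (ax1 A (A ⊃ A))) (ax1 A A)

deduction : ∀ {Γ A B} → A ∷ Γ ⊢ B → Γ ⊢ A ⊃ B
deduction {A = A} (hyp (here refl)) = axiom (⊃-refl A)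
deduction {A = A} (hyp (there p))   = axiom (ax1 _ A) · hyp p
deduction {A = A} (axiom l)         = axiom (ax1 _ A) · axiom l
deduction {A = A} (d · e)           = axiom (ax2 A _ _) · deduction d · deduction e

weaken-⊢ : ∀ {Γ A B} → Γ ⊢ A → B ∷ Γ ⊢ A
weaken-⊢ (hyp p)   = hyp (there p)
weaken-⊢ (axiom l) = axiom l
weaken-⊢ (d · e)   = weaken-⊢ d · weaken-⊢ e

hyp₀ : ∀ {Γ A} → A ∷ Γ ⊢ A
hyp₀ = hyp (here refl)

excluded-middle : ∀ {Γ A C} → A ∷ Γ ⊢ C → ∼ A ∷ Γ ⊢ C → Γ ⊢ C
excluded-middle {A = A} {C} d₁ d₂ = axiom (ax5 A (∼ A) C) · deduction d₁ · deduction d₂ · axiom (ax10 A)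

explosion : ∀ {Γ A C} → Γ ⊢ A → Γ ⊢ ∼ A → Γ ⊢ C
explosion {A = A} {C} d₁ d₂ = axiom (ax9 A C) · d₁ · d₂

∼-intro : ∀ {Γ A B} → A ∷ Γ ⊢ B → A ∷ Γ ⊢ ∼ B → Γ ⊢ ∼ A
∼-intro d₁ d₂ = excluded-middle (explosion d₁ d₂) hyp₀

signed : Bool → Formula → Formula
signed true  A = A
signed false A = ∼ A

module _ {Γ : List Formula} where

  ∼-signed : ∀ {A} a → Γ ⊢ signed a A → Γ ⊢ signed (not a) (∼ A)
  ∼-signed true  d = ∼-intro (weaken-⊢ d) hyp₀
  ∼-signed false d = d

  ⊃-signed : ∀ {A B} a b → Γ ⊢ signed a A → Γ ⊢ signed b B →
             Γ ⊢ signed (not (a ∧ not b)) (A ⊃ B)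
  ⊃-signed {A} {B} true  true  dA dB = axiom (ax1 B A) · dB
  ⊃-signed         true  false dA dB = ∼-intro (hyp₀ · weaken-⊢ dA) (weaken-⊢ dB)
  ⊃-signed {A} {B} false true  dA dB = axiom (ax1 B A) · dB
  ⊃-signed         false false dA dB = deduction (explosion hyp₀ (weaken-⊢ dA))

  •-signed : ∀ {A B} a b → Γ ⊢ signed a A → Γ ⊢ signed b B → Γ ⊢ signed (a ∧ b) (A • B)
  •-signed {A} {B} true  true  dA dB = axiom (ax8 A A B) · axiom (⊃-refl A) · (axiom (ax1 B A) · dB) · dA
  •-signed {A} {B} true  false dA dB = ∼-intro (axiom (ax7 A B) · hyp₀) (weaken-⊢ dB)
  •-signed {A} {B} false b     dA dB = ∼-intro (axiom (ax6 A B) · hyp₀) (weaken-⊢ dA)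

  ∪-signed : ∀ {A B} a b → Γ ⊢ signed a A → Γ ⊢ signed b B →
             Γ ⊢ signed (not (not a ∧ not b)) (A ∪ B)
  ∪-signed {A} {B} true  b     dA dB = axiom (ax3 A B) · dA
  ∪-signed {A} {B} false true  dA dB = axiom (ax4 A B) · dB
  ∪-signed {A} {B} false false dA dB =
    ∼-intro (axiom (ax5 A B A) · axiom (⊃-refl A) · deduction (explosion hyp₀ (weaken-⊢ (weaken-⊢ dB))) · hyp₀)
            (weaken-⊢ dA)

  ≣-signed : ∀ {A B} a b → Γ ⊢ signed a A → Γ ⊢ signed b B →
             Γ ⊢ signed (not (a ∧ not b) ∧ not (b ∧ not a)) (A ≣ B)
  ≣-signed {A} {B} true  true  dA dB =
    axiom (ax13 A B) · ⊃-signed true true dA dB · ⊃-signed true true dB dA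
  ≣-signed {A} {B} false false dA dB =
    axiom (ax13 A B) · ⊃-signed false false dA dB · ⊃-signed false false dB dA
  ≣-signed {A} {B} true  false dA dB = ∼-intro (axiom (ax11 A B) · hyp₀ · weaken-⊢ dA) (weaken-⊢ dB)
  ≣-signed {A} {B} false true  dA dB = ∼-intro (axiom (ax12 A B) · hyp₀ · weaken-⊢ dB) (weaken-⊢ dA)

atoms : Formula → List ℕ
atoms (atom a) = a ∷ []
atoms (∼ A)    = atoms A
atoms (A ⊃ B)  = atoms A ++ atoms B
atoms (A • B)  = atoms A ++ atoms B
atoms (A ∪ B)  = atoms A ++ atoms B
atoms (A ≣ B)  = atoms A ++ atoms B

Decides : Valuation → List ℕ → List Formula → Set
Decides ρ L Γ = ∀ {b} → b ∈ L → signed (ρ b) (atom b) ∈ Γ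

kalmar : ∀ ρ {Γ} Z → Decides ρ (atoms Z) Γ → Γ ⊢ signed (⟦ Z ′ ⟧ ρ) Z
kalmar ρ (atom a) h = hyp (h (here refl))
kalmar ρ (∼ A)    h = ∼-signed _ (kalmar ρ A h)
kalmar ρ (A ⊃ B)  h = ⊃-signed _ _ (kalmar ρ A (h ∘ ∈-++⁺ˡ)) (kalmar ρ B (h ∘ ∈-++⁺ʳ (atoms A)))
kalmar ρ (A • B)  h = •-signed _ _ (kalmar ρ A (h ∘ ∈-++⁺ˡ)) (kalmar ρ B (h ∘ ∈-++⁺ʳ (atoms A)))
kalmar ρ (A ∪ B)  h = ∪-signed _ _ (kalmar ρ A (h ∘ ∈-++⁺ˡ)) (kalmar ρ B (h ∘ ∈-++⁺ʳ (atoms A)))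
kalmar ρ (A ≣ B)  h = ≣-signed _ _ (kalmar ρ A (h ∘ ∈-++⁺ˡ)) (kalmar ρ B (h ∘ ∈-++⁺ʳ (atoms A)))

_[_≔_] : Valuation → ℕ → Bool → Valuation
(ρ [ a ≔ v ]) b with b ≟ a
... | yes _ = v
... | no  _ = ρ b

ProvableFromLiterals : Formula → List ℕ → Set
ProvableFromLiterals Z L = ∀ ρ Γ → Decides ρ L Γ → Γ ⊢ Z

eliminate-atom : ∀ {Z} a L → ProvableFromLiterals Z (a ∷ L) → ProvableFromLiterals Z L
eliminate-atom a L prv ρ Γ h =
  excluded-middle (prv (ρ [ a ≔ true ]) (atom a ∷ Γ) (decides true))
                  (prv (ρ [ a ≔ false ]) (∼ atom a ∷ Γ) (decides false))
  where
  decides : ∀ v → Decides (ρ [ a ≔ v ]) (a ∷ L) (signed v (atom a) ∷ Γ)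
  decides v {b} b∈ with b ≟ a
  ... | yes refl = here refl
  ... | no  b≢a  = there (h (tail b≢a b∈))

eliminate-atoms : ∀ {Z} L → ProvableFromLiterals Z L → ProvableFromLiterals Z []
eliminate-atoms []      prv = prv
eliminate-atoms (a ∷ L) prv = eliminate-atoms L (eliminate-atom a L prv)

tautology⇒LC : ∀ Z → (∀ ρ → ⟦ Z ′ ⟧ ρ ≡ true) → LC Z
tautology⇒LC Z taut = ⊢⇒LC (eliminate-atoms (atoms Z) from-atoms (λ _ → true) [] λ ())
  where
  from-atoms : ProvableFromLiterals Z (atoms Z)
  from-atoms ρ Γ h = subst (λ v → Γ ⊢ signed v Z) (taut ρ) (kalmar ρ Z h)

mainTheorem5 : (Z : Formula) → LC Z ⇔ Valid (Z ′)
mainTheorem5 Z = mk⇔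
  (λ l → valid-⇒* Rλ (LC⇒derivable l))
  (λ v → tautology⇒LC Z (λ ρ → Truth.valid⇒true ρ v))
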